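{- For any sequence $z=(z_1,z_2,\dots)$, positive integers $n_1,n_2$, integers $b_1,b_2$ and complex $\lambda_1,\lambda_2$ (such that all denominators below are nonzero), \[ Q_{n_1,b_1}(\lambda_1,z)\, Q_{n_2,b_2}(\lambda_2,z) = \sum_{k=2}^{n_1+n_2}\sum_{\ell=1}^{n_2}\frac{k!\, \binom{\lambda_1+b_1(k-\ell)+1}{k-\ell}\binom{\lambda_2+b_2\ell+1}{\ell}}{(\lambda_1+b_1(k-\ell)+1) (\lambda_2+b_2\ell+1)\binom{k}{\ell}}B_{n_1,k-\ell}(z)B_{n_2,\ell}(z). \]
   Context: The partial Bell polynomial is $B_{n,k}(z)=\sum\frac{n!}{i_1!i_2!\cdots}\left(\frac{z_1}{1!}\right)^{i_1}\left(\frac{z_2}{2!}\right)^{i_2}\cdots$, summed over all sequences $(i_1,i_2,\dots)$ of nonnegative integers with $i_1+i_2+\dots=k$ and $i_1+2i_2+\dots=n$ (so $B_{n,0}=0$ for $n\ge1$). For $n\in\mathbb{N}$, $b\in\mathbb{Z}$, $\lambda\in\mathbb{C}$, $Q_{n,b}(\lambda,z)=\sum_{k=1}^{n}\binom{\lambda+bk}{k-1}(k-1)!\,B_{n,k}(z)$, with generalized binomial coefficients. -}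

module Defs where

open import Level using (Level; _⊔_) renaming (suc to lsuc)
open import Algebra.Bundles using (CommutativeRing)
open import Data.Nat as ℕ using (ℕ; zero; suc; _∸_; _≡ᵇ_)
open import Data.Nat.Combinatorics using (_C_)
open import Data.Nat.Base using (_!)
open import Data.Integer as ℤ using (ℤ; +_; -[1+_])
open import Data.List as List using (List; []; _∷_; upTo; map; concatMap; filter; foldr)
open import Data.Bool using (Bool; true; false; _∧_; T)
open import Relation.Nullary using (¬_)

ringFromℕ : ∀ {c ℓ} (R : CommutativeRing c ℓ) → ℕ → CommutativeRing.Carrier R
ringFromℕ R zero    = CommutativeRing.0# R
ringFromℕ R (suc n) = CommutativeRing._+_ R (CommutativeRing.1# R) (ringFromℕ R n)

-- A field of characteristic zero (classical presentation: total inverse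
-- function, specified only on nonzero elements).  ℂ is an instance.
record Char0Field (c ℓ : Level) : Set (lsuc (c ⊔ ℓ)) where
  field
    commRing : CommutativeRing c ℓ
  open CommutativeRing commRing
  field
    _⁻¹      : Carrier → Carrier
    inverse  : ∀ x → ¬ (x ≈ 0#) → x * (x ⁻¹) ≈ 1#
    char-0   : ∀ n → ¬ (ringFromℕ commRing (suc n) ≈ 0#)

module Ops {c ℓ : Level} (F : Char0Field c ℓ) where
  open Char0Field F public
  open CommutativeRing commRing public

  fromℕ : ℕ → Carrier
  fromℕ = ringFromℕ commRing

  fromℤ : ℤ → Carrier
  fromℤ (+ n)      = fromℕ n
  fromℤ -[1+ n ]   = - fromℕ (suc n)

  pow : Carrier → ℕ → Carrier
  pow x zero    = 1#
  pow x (suc n) = pow x n * x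

  falling : Carrier → ℕ → Carrier
  falling x zero    = 1#
  falling x (suc j) = falling x j * (x - fromℕ j)

  binom : Carrier → ℕ → Carrier
  binom x j = falling x j * (fromℕ (j !) ⁻¹)

  ∑ : List ℕ → (ℕ → Carrier) → Carrier
  ∑ is f = foldr (λ i acc → f i + acc) 0# is

  range : ℕ → ℕ → List ℕ
  range a b = map (a ℕ.+_) (upTo (suc b ∸ a))

  seqs : ℕ → ℕ → List (List ℕ)
  seqs zero    m = [] ∷ []
  seqs (suc l) m = concatMap (λ i → map (i ∷_) (seqs l m)) (upTo (suc m))

  -- Σ i_j  and  Σ j·i_j  for a list (i_s, i_{s+1}, …) starting at index s
  total : List ℕ → ℕ
  total = foldr ℕ._+_ 0

  weight : ℕ → List ℕ → ℕ
  weight s []       = 0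
  weight s (i ∷ is) = s ℕ.* i ℕ.+ weight (suc s) is

  monomial : (ℕ → Carrier) → ℕ → List ℕ → Carrier
  monomial z s []       = 1#
  monomial z s (i ∷ is) =
    (fromℕ (i !) ⁻¹) * pow (z s * (fromℕ (s !) ⁻¹)) i * monomial z (suc s) is

  -- partial Bell polynomial B_{n,k}(z); z j is z_j (z 0 is unused).
  -- Sequences (i₁,i₂,…) with Σ j i_j = n have i_j = 0 for j > n and
  -- i_j ≤ n, so the sum ranges over (i₁,…,i_n) ∈ {0..n}^n.
  B : ℕ → ℕ → (ℕ → Carrier) → Carrier
  B n k z =
    List.foldr (λ is acc → fromℕ (n !) * monomial z 1 is + acc) 0#
      (filter (λ is → T? ((total is ≡ᵇ k) ∧ (weight 1 is ≡ᵇ n))) (seqs n n))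
    where
    open import Relation.Nullary.Decidable using (Dec; yes; no)
    open import Data.Bool.Properties using (T?)

  Q : ℕ → ℤ → Carrier → (ℕ → Carrier) → Carrier
  Q n b λ' z = ∑ (range 1 n) (λ k →
    binom (λ' + fromℤ b * fromℕ k) (k ∸ 1) * fromℕ ((k ∸ 1) !) * B n k z)

  rhsTerm : ℕ → ℕ → ℤ → ℤ → Carrier → Carrier → (ℕ → Carrier) → ℕ → ℕ → Carrier
  rhsTerm n₁ n₂ b₁ b₂ λ₁ λ₂ z k l =
    fromℕ (k !)
      * binom (λ₁ + fromℤ b₁ * fromℕ (k ∸ l) + 1#) (k ∸ l)
      * binom (λ₂ + fromℤ b₂ * fromℕ l + 1#) l
      * ((λ₁ + fromℤ b₁ * fromℕ (k ∸ l) + 1#) ⁻¹)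
      * ((λ₂ + fromℤ b₂ * fromℕ l + 1#) ⁻¹)
      * (fromℕ (k C l) ⁻¹)
      * B n₁ (k ∸ l) z * B n₂ l z

-- The (k, l) summand of the right-hand side is exactly q₁(k-l)·q₂(l), where
-- q(j) = binom(λ + b j, j-1) (j-1)! B_{n,j} is the j-th summand of Q.  This follows from
-- k!/binom(k,l) = l! (k-l)! and the absorption identity
--   binom(x+1, m) m! / (x+1) = binom(x, m-1) (m-1)!,
-- both sides being the falling factorial x(x-1)⋯(x-m+2).  So the right-hand side is the
-- product of the two sums reindexed by k = j + l; the terms gained or lost in reindexing
-- vanish because B_{n,0} = 0 for n ≥ 1 and B_{n,j} = 0 for j > n.
module Submission where

open import Defs
open import Level using (Level)
open import Data.Nat as ℕ using (ℕ; _∸_; _≤_; _<_)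
open import Data.Integer using (ℤ)
open import Data.Product using (_×_)
open import Relation.Nullary using (¬_)

open import Data.Nat using (zero; suc; z≤n; s≤s; _!; _≡ᵇ_; _<?_)
import Data.Nat.Properties as ℕₚ
open import Data.Nat.Combinatorics using (_C_; nCk≡n!/k![n-k]!; k![n∸k]!∣n!)
open import Data.Nat.DivMod using (m*[n/m]≡n)
open import Data.Fin using (toℕ)
open import Data.Fin.Properties using (toℕ<n)
open import Data.List using ([]; _∷_; applyUpTo; foldr)
open import Data.List.Properties using (map-upTo; filter-none)
open import Data.List.Relation.Unary.All using (universal)
open import Data.Bool using (T; _∧_)
open import Data.Bool.Properties using (T?; T-∧)
open import Data.Product using (_,_)
open import Data.Empty using (⊥)
open import Function using (_∘_; Equivalence)
open import Relation.Nullary using (yes; no)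
import Relation.Binary.PropositionalEquality as ≡
open ≡ using (_≡_; _≢_)

k!≡kCl*l!*[k∸l]! : ∀ {k l} → l ≤ k → k ! ≡ (k C l) ℕ.* (l ! ℕ.* (k ∸ l) !)
k!≡kCl*l!*[k∸l]! {k} {l} l≤k = begin
  k !                                     ≡⟨ m*[n/m]≡n (k![n∸k]!∣n! l≤k) ⟨
  l![k∸l]! ℕ.* (k ! ℕ./ l![k∸l]!)         ≡⟨ ≡.cong (l![k∸l]! ℕ.*_) (nCk≡n!/k![n-k]! l≤k) ⟨
  l![k∸l]! ℕ.* (k C l)                    ≡⟨ ℕₚ.*-comm l![k∸l]! (k C l) ⟩
  (k C l) ℕ.* l![k∸l]!                    ∎
  where
  open ≡.≡-Reasoning
  l![k∸l]! : ℕ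
  l![k∸l]! = l ! ℕ.* (k ∸ l) !
  instance
    l![k∸l]!≢0 : ℕ.NonZero l![k∸l]!
    l![k∸l]!≢0 = l ℕₚ.!* (k ∸ l) !≢0

module ProductFormula {c ℓ : Level} (F : Char0Field c ℓ) where
  open Ops F
  open import Relation.Binary.Reasoning.Setoid setoid
  open import Algebra.Properties.CommutativeSemigroup *-commutativeSemigroup using (xy∙z≈xz∙y)
  open import Algebra.Properties.AbelianGroup +-abelianGroup using (⁻¹-∙-comm; ε⁻¹≈ε)
  open import Algebra.Properties.Semiring.Mult semiring using (×1-homo-*) renaming (_×_ to _·_)
  open import Algebra.Properties.Semiring.Sum semiring
    using (sum-syntax; sum-cong-≋; sum-cong-≗; sum-replicate-zero; ∑-comm; *-distribˡ-sum; *-distribʳ-sum)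
  open import Algebra.Solver.CommutativeMonoid *-commutativeMonoid using (solve; _⊜_; _⊕_)

  total≤weight : ∀ s is → total is ≤ weight (suc s) is
  total≤weight s []       = z≤n
  total≤weight s (i ∷ is) = ℕₚ.+-mono-≤ (ℕₚ.m≤m+n i (s ℕ.* i)) (total≤weight (suc s) is)

  total≡0⇒weight≡0 : ∀ s is → total is ≡ 0 → weight s is ≡ 0
  total≡0⇒weight≡0 s []          _   = ≡.refl
  total≡0⇒weight≡0 s (zero ∷ is) t≡0 = ≡.cong₂ ℕ._+_ (ℕₚ.*-zeroʳ s) (total≡0⇒weight≡0 (suc s) is t≡0)

  B-vanishes : ∀ {n k} z → (∀ is → total is ≡ k → weight 1 is ≡ n → ⊥) → B n k z ≡ 0#
  B-vanishes {n} {k} z inadmissible =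
    ≡.cong (foldr (λ is acc → fromℕ (n !) * monomial z 1 is + acc) 0#)
      (filter-none (λ is → T? ((total is ≡ᵇ k) ∧ (weight 1 is ≡ᵇ n))) (universal rejected (seqs n n)))
    where
    rejected : ∀ is → ¬ T ((total is ≡ᵇ k) ∧ (weight 1 is ≡ᵇ n))
    rejected is t = let (t≡k , w≡n) = Equivalence.to T-∧ t in
      inadmissible is (ℕₚ.≡ᵇ⇒≡ _ _ t≡k) (ℕₚ.≡ᵇ⇒≡ _ _ w≡n)

  n<k⇒B≡0 : ∀ {n k} z → n < k → B n k z ≡ 0#
  n<k⇒B≡0 z n<k = B-vanishes z λ is t≡k w≡n →
    ℕₚ.<⇒≱ n<k (≡.subst₂ _≤_ t≡k w≡n (total≤weight 0 is))

  B[n,0]≡0 : ∀ {n} z → 1 ≤ n → B n 0 z ≡ 0#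
  B[n,0]≡0 z 1≤n = B-vanishes z λ is t≡0 w≡n →
    ℕₚ.n>0⇒n≢0 1≤n (≡.trans (≡.sym w≡n) (total≡0⇒weight≡0 1 is t≡0))

  fromℕ≡×1 : ∀ n → fromℕ n ≡ n · 1#
  fromℕ≡×1 zero    = ≡.refl
  fromℕ≡×1 (suc n) = ≡.cong (1# +_) (fromℕ≡×1 n)

  fromℕ-* : ∀ m n → fromℕ (m ℕ.* n) ≈ fromℕ m * fromℕ n
  fromℕ-* m n = begin
    fromℕ (m ℕ.* n)         ≡⟨ fromℕ≡×1 (m ℕ.* n) ⟩
    (m ℕ.* n) · 1#          ≈⟨ ×1-homo-* m n ⟩
    (m · 1#) * (n · 1#)     ≡⟨ ≡.cong₂ _*_ (fromℕ≡×1 m) (fromℕ≡×1 n) ⟨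
    fromℕ m * fromℕ n       ∎

  fromℕ-≉0 : ∀ {n} → n ≢ 0 → ¬ fromℕ n ≈ 0#
  fromℕ-≉0 {zero}  n≢0 = λ _ → n≢0 ≡.refl
  fromℕ-≉0 {suc n} _   = char-0 n

  fromℕ[n!]≉0 : ∀ n → ¬ fromℕ (n !) ≈ 0#
  fromℕ[n!]≉0 n = fromℕ-≉0 (ℕₚ.n>0⇒n≢0 (ℕₚ.1≤n! n))

  x⁻¹*x≈1 : ∀ {x} → ¬ x ≈ 0# → x ⁻¹ * x ≈ 1#
  x⁻¹*x≈1 {x} x≉0 = trans (*-comm (x ⁻¹) x) (inverse x x≉0)

  x*y*x⁻¹≈y : ∀ {x} y → ¬ x ≈ 0# → x * y * x ⁻¹ ≈ y
  x*y*x⁻¹≈y {x} y x≉0 = begin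
    x * y * x ⁻¹     ≈⟨ xy∙z≈xz∙y x y (x ⁻¹) ⟩
    x * x ⁻¹ * y     ≈⟨ *-congʳ (inverse x x≉0) ⟩
    1# * y           ≈⟨ *-identityˡ y ⟩
    y                ∎

  k!/kCl≈l!*[k∸l]! : ∀ {k l} → l ≤ k → fromℕ (k !) * fromℕ (k C l) ⁻¹ ≈ fromℕ (l !) * fromℕ ((k ∸ l) !)
  k!/kCl≈l!*[k∸l]! {k} {l} l≤k = begin
    fromℕ (k !) * Cₖₗ ⁻¹                                ≡⟨ ≡.cong (λ n → fromℕ n * Cₖₗ ⁻¹) k!≡ ⟩
    fromℕ ((k C l) ℕ.* (l ! ℕ.* (k ∸ l) !)) * Cₖₗ ⁻¹ ≈⟨ *-congʳ (trans (fromℕ-* (k C l) _) (*-congˡ (fromℕ-* (l !) ((k ∸ l) !)))) ⟩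
    Cₖₗ * (fromℕ (l !) * fromℕ ((k ∸ l) !)) * Cₖₗ ⁻¹    ≈⟨ x*y*x⁻¹≈y _ (fromℕ-≉0 kCl≢0) ⟩
    fromℕ (l !) * fromℕ ((k ∸ l) !)                  ∎
    where
    Cₖₗ : Carrier
    Cₖₗ = fromℕ (k C l)
    k!≡ : k ! ≡ (k C l) ℕ.* (l ! ℕ.* (k ∸ l) !)
    k!≡ = k!≡kCl*l!*[k∸l]! l≤k
    kCl≢0 : k C l ≢ 0
    kCl≢0 kCl≡0 = ℕₚ.n>0⇒n≢0 (ℕₚ.1≤n! k) (≡.trans k!≡ (≡.cong (ℕ._* (l ! ℕ.* (k ∸ l) !)) kCl≡0))

  binom*!≈falling : ∀ x m → binom x m * fromℕ (m !) ≈ falling x m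
  binom*!≈falling x m = begin
    falling x m * fromℕ (m !) ⁻¹ * fromℕ (m !)   ≈⟨ *-assoc _ _ _ ⟩
    falling x m * (fromℕ (m !) ⁻¹ * fromℕ (m !)) ≈⟨ *-congˡ (x⁻¹*x≈1 (fromℕ[n!]≉0 m)) ⟩
    falling x m * 1#                              ≈⟨ *-identityʳ _ ⟩
    falling x m                                   ∎

  [x+1]-[1+y]≈x-y : ∀ x y → (x + 1#) - (1# + y) ≈ x - y
  [x+1]-[1+y]≈x-y x y = begin
    (x + 1#) + - (1# + y)      ≈⟨ +-congˡ (sym (⁻¹-∙-comm 1# y)) ⟩
    (x + 1#) + (- 1# + - y)    ≈⟨ +-assoc _ _ _ ⟩
    x + (1# + (- 1# + - y))    ≈⟨ +-congˡ (sym (+-assoc _ _ _)) ⟩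
    x + ((1# + - 1#) + - y)    ≈⟨ +-congˡ (+-congʳ (-‿inverseʳ 1#)) ⟩
    x + (0# + - y)             ≈⟨ +-congˡ (+-identityˡ _) ⟩
    x - y                      ∎

  falling-suc : ∀ x m → falling (x + 1#) (suc m) ≈ (x + 1#) * falling x m
  falling-suc x zero = begin
    1# * ((x + 1#) - 0#)   ≈⟨ *-identityˡ _ ⟩
    (x + 1#) - 0#          ≈⟨ +-congˡ ε⁻¹≈ε ⟩
    (x + 1#) + 0#          ≈⟨ +-identityʳ _ ⟩
    x + 1#                 ≈⟨ *-identityʳ _ ⟨
    (x + 1#) * 1#          ∎
  falling-suc x (suc m) = begin
    falling (x + 1#) (suc m) * ((x + 1#) - fromℕ (suc m))  ≈⟨ *-cong (falling-suc x m) ([x+1]-[1+y]≈x-y x (fromℕ m)) ⟩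
    (x + 1#) * falling x m * (x - fromℕ m)                 ≈⟨ *-assoc _ _ _ ⟩
    (x + 1#) * (falling x m * (x - fromℕ m))               ∎

  binom-absorption : ∀ x {m} → 1 ≤ m → ¬ x + 1# ≈ 0# →
    binom (x + 1#) m * (x + 1#) ⁻¹ * fromℕ (m !) ≈ binom x (m ∸ 1) * fromℕ ((m ∸ 1) !)
  binom-absorption x {suc m} _ x+1≉0 = begin
    binom (x + 1#) (suc m) * (x + 1#) ⁻¹ * fromℕ (suc m !)  ≈⟨ xy∙z≈xz∙y _ _ _ ⟩
    binom (x + 1#) (suc m) * fromℕ (suc m !) * (x + 1#) ⁻¹  ≈⟨ *-congʳ (binom*!≈falling (x + 1#) (suc m)) ⟩
    falling (x + 1#) (suc m) * (x + 1#) ⁻¹                  ≈⟨ *-congʳ (falling-suc x m) ⟩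
    (x + 1#) * falling x m * (x + 1#) ⁻¹                    ≈⟨ x*y*x⁻¹≈y _ x+1≉0 ⟩
    falling x m                                             ≈⟨ binom*!≈falling x m ⟨
    binom x m * fromℕ (m !)                                 ∎

  ∑< : ℕ → (ℕ → Carrier) → Carrier
  ∑< n f = ∑[ i < n ] f (toℕ i)

  ∑-applyUpTo : ∀ h m f → ∑ (applyUpTo h m) f ≡ ∑< m (f ∘ h)
  ∑-applyUpTo h zero    f = ≡.refl
  ∑-applyUpTo h (suc m) f = ≡.cong (f (h 0) +_) (∑-applyUpTo (h ∘ suc) m f)

  ∑-range : ∀ a b f → ∑ (range a b) f ≡ ∑< (suc b ∸ a) (λ i → f (a ℕ.+ i))
  ∑-range a b f = ≡.trans (≡.cong (λ is → ∑ is f) (map-upTo (a ℕ.+_) (suc b ∸ a)))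
                          (∑-applyUpTo (a ℕ.+_) (suc b ∸ a) f)

  ∑<-cong : ∀ {m f g} → (∀ i → i < m → f i ≈ g i) → ∑< m f ≈ ∑< m g
  ∑<-cong {m} f≈g = sum-cong-≋ {m} (λ i → f≈g (toℕ i) (toℕ<n i))

  ∑<-zero : ∀ m {f} → (∀ i → f i ≈ 0#) → ∑< m f ≈ 0#
  ∑<-zero m f≈0 = trans (sum-cong-≋ {m} (λ i → f≈0 (toℕ i))) (sum-replicate-zero m)

  ∑<-dropPrefix : ∀ a m f → (∀ i → i < a → f i ≈ 0#) → ∑< (a ℕ.+ m) f ≈ ∑< m (λ i → f (a ℕ.+ i))
  ∑<-dropPrefix zero    m f _   = refl
  ∑<-dropPrefix (suc a) m f f≈0 = begin
    f 0 + ∑< (a ℕ.+ m) (f ∘ suc)   ≈⟨ +-congʳ (f≈0 0 (s≤s z≤n)) ⟩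
    0# + ∑< (a ℕ.+ m) (f ∘ suc)    ≈⟨ +-identityˡ _ ⟩
    ∑< (a ℕ.+ m) (f ∘ suc)         ≈⟨ ∑<-dropPrefix a m (f ∘ suc) (λ i i<a → f≈0 (suc i) (s≤s i<a)) ⟩
    ∑< m (λ i → f (suc a ℕ.+ i))   ∎

  ∑<-dropSuffix : ∀ m r f → (∀ i → m ≤ i → f i ≈ 0#) → ∑< (m ℕ.+ r) f ≈ ∑< m f
  ∑<-dropSuffix zero    r f f≈0 = ∑<-zero r (λ i → f≈0 i z≤n)
  ∑<-dropSuffix (suc m) r f f≈0 = +-congˡ (∑<-dropSuffix m r (f ∘ suc) (λ i m≤i → f≈0 (suc i) (s≤s m≤i)))

  ∑<-reindex : ∀ l m r g → g 0 ≈ 0# → (∀ j → m ≤ j → g j ≈ 0#) →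
    ∑< (l ℕ.+ (m ℕ.+ r)) (λ k → g (k ∸ l)) ≈ ∑< m g
  ∑<-reindex l m r g g0≈0 g≈0 = begin
    ∑< (l ℕ.+ (m ℕ.+ r)) (λ k → g (k ∸ l))  ≈⟨ ∑<-dropPrefix l (m ℕ.+ r) _ k<l⇒g[k∸l]≈0 ⟩
    ∑< (m ℕ.+ r) (λ i → g (l ℕ.+ i ∸ l))   ≡⟨ sum-cong-≗ {m ℕ.+ r} (λ i → ≡.cong g (ℕₚ.m+n∸m≡n l (toℕ i))) ⟩
    ∑< (m ℕ.+ r) g                         ≈⟨ ∑<-dropSuffix m r g g≈0 ⟩
    ∑< m g                                 ∎
    where
    k<l⇒g[k∸l]≈0 : ∀ k → k < l → g (k ∸ l) ≈ 0#
    k<l⇒g[k∸l]≈0 k k<l = trans (reflexive (≡.cong g (ℕₚ.m≤n⇒m∸n≡0 (ℕₚ.<⇒≤ k<l)))) g0≈0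

  ∑<-*-convolution : ∀ m n f g → f 0 ≈ 0# → (∀ j → m < j → f j ≈ 0#) →
    ∑< (suc m) f * ∑< n g ≈ ∑< (suc (m ℕ.+ n)) (λ k → ∑< n (λ l → f (k ∸ suc l) * g l))
  ∑<-*-convolution m n f g f0≈0 f≈0 = begin
    ∑< (suc m) f * ∑< n g                                           ≈⟨ *-distribˡ-sum {n} (∑< (suc m) f) (g ∘ toℕ) ⟩
    ∑< n (λ l → ∑< (suc m) f * g l)                                 ≈⟨ sum-cong-≋ {n} (λ l → *-distribʳ-sum {suc m} (g (toℕ l)) (f ∘ toℕ)) ⟩
    ∑< n (λ l → ∑< (suc m) (λ j → f j * g l))                       ≈⟨ ∑<-cong shift ⟩
    ∑< n (λ l → ∑< (suc (m ℕ.+ n)) (λ k → f (k ∸ suc l) * g l))     ≈⟨ ∑-comm {n} {suc (m ℕ.+ n)} (λ l k → f (toℕ k ∸ suc (toℕ l)) * g (toℕ l)) ⟩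
    ∑< (suc (m ℕ.+ n)) (λ k → ∑< n (λ l → f (k ∸ suc l) * g l))     ∎
    where
    shift : ∀ l → l < n → ∑< (suc m) (λ j → f j * g l) ≈ ∑< (suc (m ℕ.+ n)) (λ k → f (k ∸ suc l) * g l)
    shift l l<n = begin
      ∑< (suc m) (λ j → f j * g l)
        ≈⟨ ∑<-reindex (suc l) (suc m) r (λ j → f j * g l) (trans (*-congʳ f0≈0) (zeroˡ _))
                                          (λ j m<j → trans (*-congʳ (f≈0 j m<j)) (zeroˡ _)) ⟨
      ∑< (suc l ℕ.+ (suc m ℕ.+ r)) (λ k → f (k ∸ suc l) * g l)
        ≡⟨ ≡.cong (λ N → ∑< N (λ k → f (k ∸ suc l) * g l)) size ⟩
      ∑< (suc (m ℕ.+ n)) (λ k → f (k ∸ suc l) * g l) ∎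
      where
      r : ℕ
      r = n ∸ suc l
      size : suc l ℕ.+ (suc m ℕ.+ r) ≡ suc m ℕ.+ n
      size = ≡.trans (x∙yz≈y∙xz (suc l) (suc m) r) (≡.cong (suc m ℕ.+_) (ℕₚ.m+[n∸m]≡n l<n))
        where open import Algebra.Properties.CommutativeSemigroup ℕₚ.+-commutativeSemigroup using (x∙yz≈y∙xz)

  x*0#*y≈0# : ∀ x y → x * 0# * y ≈ 0#
  x*0#*y≈0# x y = trans (*-congʳ (zeroʳ x)) (zeroˡ y)

  qTerm : ℕ → ℤ → Carrier → (ℕ → Carrier) → ℕ → Carrier
  qTerm n b x z k = binom (x + fromℤ b * fromℕ k) (k ∸ 1) * fromℕ ((k ∸ 1) !) * B n k z

  qTerm[0]≈0 : ∀ {n} b x z → 1 ≤ n → qTerm n b x z 0 ≈ 0#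
  qTerm[0]≈0 b x z 1≤n = trans (*-congˡ (reflexive (B[n,0]≡0 z 1≤n))) (zeroʳ _)

  n<k⇒qTerm≈0 : ∀ {n k} b x z → n < k → qTerm n b x z k ≈ 0#
  n<k⇒qTerm≈0 b x z n<k = trans (*-congˡ (reflexive (n<k⇒B≡0 z n<k))) (zeroʳ _)

  Q≈∑<qTerm : ∀ {n} b x z → 1 ≤ n → Q n b x z ≈ ∑< (suc n) (qTerm n b x z)
  Q≈∑<qTerm {n} b x z 1≤n = begin
    Q n b x z                   ≡⟨ ∑-range 1 n q ⟩
    ∑< n (q ∘ suc)              ≈⟨ +-identityˡ _ ⟨
    0# + ∑< n (q ∘ suc)         ≈⟨ +-congʳ (qTerm[0]≈0 b x z 1≤n) ⟨
    ∑< (suc n) q                ∎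
    where
    q : ℕ → Carrier
    q = qTerm n b x z

  module Summands (z : ℕ → Carrier) (n₁ n₂ : ℕ) (b₁ b₂ : ℤ) (λ₁ λ₂ : Carrier) where

    rhsTerm-factorises : ∀ {k l} → 1 ≤ l → l < k →
      ¬ (λ₁ + fromℤ b₁ * fromℕ (k ∸ l) + 1# ≈ 0#) → ¬ (λ₂ + fromℤ b₂ * fromℕ l + 1# ≈ 0#) →
      rhsTerm n₁ n₂ b₁ b₂ λ₁ λ₂ z k l ≈ qTerm n₁ b₁ λ₁ z (k ∸ l) * qTerm n₂ b₂ λ₂ z l
    rhsTerm-factorises {k} {l} 1≤l l<k X≉0 Y≉0 = begin
      K * β₁ * β₂ * X ⁻¹ * Y ⁻¹ * Cₖₗ ⁻¹ * B₁ * B₂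
        ≈⟨ solve 8 (λ K β₁ β₂ X⁻¹ Y⁻¹ Cₖₗ⁻¹ B₁ B₂ →
                      ((((((K ⊕ β₁) ⊕ β₂) ⊕ X⁻¹) ⊕ Y⁻¹) ⊕ Cₖₗ⁻¹) ⊕ B₁) ⊕ B₂
                   ⊜ (K ⊕ Cₖₗ⁻¹) ⊕ (((β₁ ⊕ X⁻¹) ⊕ B₁) ⊕ ((β₂ ⊕ Y⁻¹) ⊕ B₂)))
                  refl K β₁ β₂ (X ⁻¹) (Y ⁻¹) (Cₖₗ ⁻¹) B₁ B₂ ⟩
      (K * Cₖₗ ⁻¹) * ((β₁ * X ⁻¹ * B₁) * (β₂ * Y ⁻¹ * B₂))
        ≈⟨ *-congʳ (k!/kCl≈l!*[k∸l]! (ℕₚ.<⇒≤ l<k)) ⟩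
      (L * J) * ((β₁ * X ⁻¹ * B₁) * (β₂ * Y ⁻¹ * B₂))
        ≈⟨ solve 8 (λ L J β₁ β₂ X⁻¹ Y⁻¹ B₁ B₂ →
                      (L ⊕ J) ⊕ (((β₁ ⊕ X⁻¹) ⊕ B₁) ⊕ ((β₂ ⊕ Y⁻¹) ⊕ B₂))
                   ⊜ (((β₁ ⊕ X⁻¹) ⊕ J) ⊕ B₁) ⊕ (((β₂ ⊕ Y⁻¹) ⊕ L) ⊕ B₂))
                  refl L J β₁ β₂ (X ⁻¹) (Y ⁻¹) B₁ B₂ ⟩
      (β₁ * X ⁻¹ * J * B₁) * (β₂ * Y ⁻¹ * L * B₂)
        ≈⟨ *-cong (*-congʳ (binom-absorption _ (ℕₚ.m<n⇒0<n∸m l<k) X≉0))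
                  (*-congʳ (binom-absorption _ 1≤l Y≉0)) ⟩
      qTerm n₁ b₁ λ₁ z (k ∸ l) * qTerm n₂ b₂ λ₂ z l ∎
      where
      X Y K Cₖₗ L J β₁ β₂ B₁ B₂ : Carrier
      X   = λ₁ + fromℤ b₁ * fromℕ (k ∸ l) + 1#
      Y   = λ₂ + fromℤ b₂ * fromℕ l + 1#
      K   = fromℕ (k !)
      Cₖₗ = fromℕ (k C l)
      L   = fromℕ (l !)
      J   = fromℕ ((k ∸ l) !)
      β₁  = binom X (k ∸ l)
      β₂  = binom Y l
      B₁  = B n₁ (k ∸ l) z
      B₂  = B n₂ l z

    rhsTerm-vanishes : ∀ {k l} → 1 ≤ n₁ → k ≤ l → rhsTerm n₁ n₂ b₁ b₂ λ₁ λ₂ z k l ≈ 0#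
    rhsTerm-vanishes {k} {l} 1≤n₁ k≤l = trans (*-congʳ (*-congˡ (reflexive B₁≡0))) (x*0#*y≈0# _ _)
      where
      B₁≡0 : B n₁ (k ∸ l) z ≡ 0#
      B₁≡0 = ≡.trans (≡.cong (λ j → B n₁ j z) (ℕₚ.m≤n⇒m∸n≡0 k≤l)) (B[n,0]≡0 z 1≤n₁)

    rhsTerm≈qTerm*qTerm : ∀ {k l} → 1 ≤ n₁ → 1 ≤ l →
      (l < k → ¬ (λ₁ + fromℤ b₁ * fromℕ (k ∸ l) + 1# ≈ 0#) × ¬ (λ₂ + fromℤ b₂ * fromℕ l + 1# ≈ 0#)) →
      rhsTerm n₁ n₂ b₁ b₂ λ₁ λ₂ z k l ≈ qTerm n₁ b₁ λ₁ z (k ∸ l) * qTerm n₂ b₂ λ₂ z l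
    rhsTerm≈qTerm*qTerm {k} {l} 1≤n₁ 1≤l nonsingular with l <? k
    ... | yes l<k = let (X≉0 , Y≉0) = nonsingular l<k in rhsTerm-factorises 1≤l l<k X≉0 Y≉0
    ... | no  l≮k = begin
      rhsTerm n₁ n₂ b₁ b₂ λ₁ λ₂ z k l                  ≈⟨ rhsTerm-vanishes 1≤n₁ k≤l ⟩
      0#                                               ≈⟨ zeroˡ _ ⟨
      0# * qTerm n₂ b₂ λ₂ z l                          ≈⟨ *-congʳ q₁≈0 ⟨
      qTerm n₁ b₁ λ₁ z (k ∸ l) * qTerm n₂ b₂ λ₂ z l   ∎
      where
      k≤l : k ≤ l
      k≤l = ℕₚ.≮⇒≥ l≮k
      q₁≈0 : qTerm n₁ b₁ λ₁ z (k ∸ l) ≈ 0#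
      q₁≈0 = trans (reflexive (≡.cong (qTerm n₁ b₁ λ₁ z) (ℕₚ.m≤n⇒m∸n≡0 k≤l))) (qTerm[0]≈0 b₁ λ₁ z 1≤n₁)

lemma4p2 : ∀ {c ℓ : Level} (F : Char0Field c ℓ) → let open Ops F in
    (z : ℕ → Carrier) (n₁ n₂ : ℕ) → 1 ≤ n₁ → 1 ≤ n₂ →
    (b₁ b₂ : ℤ) (λ₁ λ₂ : Carrier) →
    (∀ k l → 2 ≤ k → k ≤ n₁ ℕ.+ n₂ → 1 ≤ l → l ≤ n₂ → l < k →
      ¬ (λ₁ + fromℤ b₁ * fromℕ (k ∸ l) + 1# ≈ 0#) × ¬ (λ₂ + fromℤ b₂ * fromℕ l + 1# ≈ 0#)) →
    Q n₁ b₁ λ₁ z * Q n₂ b₂ λ₂ z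
      ≈ ∑ (range 2 (n₁ ℕ.+ n₂)) (λ k → ∑ (range 1 n₂) (λ l → rhsTerm n₁ n₂ b₁ b₂ λ₁ λ₂ z k l))
-- Taking n₁ = suc _ makes suc N and 2 + (N ∸ 1) definitionally equal.
lemma4p2 F z n₁@(suc _) n₂ 1≤n₁ _ b₁ b₂ λ₁ λ₂ nonsingular = begin
  Q n₁ b₁ λ₁ z * Q n₂ b₂ λ₂ z
    ≈⟨ *-cong (Q≈∑<qTerm b₁ λ₁ z 1≤n₁) (reflexive (∑-range 1 n₂ q₂)) ⟩
  ∑< (suc n₁) q₁ * ∑< n₂ (q₂ ∘ suc)
    ≈⟨ ∑<-*-convolution n₁ n₂ q₁ (q₂ ∘ suc) (qTerm[0]≈0 b₁ λ₁ z 1≤n₁) (λ j → n<k⇒qTerm≈0 b₁ λ₁ z) ⟩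
  ∑< (suc N) (λ k → ∑< n₂ (λ l → q₁ (k ∸ suc l) * q₂ (suc l)))
    ≈⟨ ∑<-cong {suc N} (λ k k<1+N → ∑<-cong {n₂} (λ l l<n₂ →
         sym (rhsTerm≈qTerm*qTerm {k} {suc l} 1≤n₁ (s≤s z≤n) (λ l<k →
           nonsingular k (suc l) (ℕₚ.≤-trans (s≤s (s≤s z≤n)) l<k) (ℕₚ.≤-pred k<1+N) (s≤s z≤n) l<n₂ l<k)))) ⟩
  ∑< (suc N) (λ k → ∑< n₂ (λ l → rhs k (suc l)))
    ≈⟨ ∑<-dropPrefix 2 (N ∸ 1) (λ k → ∑< n₂ (λ l → rhs k (suc l))) (λ k k<2 → ∑<-zero n₂ (λ l →
         rhsTerm-vanishes {k} {suc l} 1≤n₁ (ℕₚ.≤-trans (ℕₚ.≤-pred k<2) (s≤s z≤n)))) ⟩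
  ∑< (N ∸ 1) (λ k → ∑< n₂ (λ l → rhs (2 ℕ.+ k) (suc l)))
    ≈⟨ ∑<-cong {N ∸ 1} (λ k _ → reflexive (∑-range 1 n₂ (rhs (2 ℕ.+ k)))) ⟨
  ∑< (N ∸ 1) (λ k → ∑ (range 1 n₂) (rhs (2 ℕ.+ k)))
    ≡⟨ ∑-range 2 N (λ k → ∑ (range 1 n₂) (rhs k)) ⟨
  ∑ (range 2 N) (λ k → ∑ (range 1 n₂) (rhs k)) ∎
  where
  open Ops F
  open ProductFormula F
  open Summands z n₁ n₂ b₁ b₂ λ₁ λ₂
  open import Relation.Binary.Reasoning.Setoid setoid
  N : ℕ
  N = n₁ ℕ.+ n₂
  q₁ q₂ : ℕ → Carrier
  q₁ = qTerm n₁ b₁ λ₁ z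
  q₂ = qTerm n₂ b₂ λ₂ z
  rhs : ℕ → ℕ → Carrier
  rhs = rhsTerm n₁ n₂ b₁ b₂ λ₁ λ₂ z
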